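{- Let $K_n$ be the complete graph on $n$ vertices and $k$ a positive integer. For any integer $0\le j\le n-k$, $$\chi_j^k(K_n)=\begin{cases} 0 & \text{if } k\ge n,\\ |E(K_{n-j})|-|T(n-j,k)| & \text{if } k<n.\end{cases}$$
   Context: For a positive integer $k$, a nonnegative integer $j$ and a simple graph $G=(V,E)$, a set $E'\subseteq E$ is a $k$-chromatic number $j$-mixed edge removal set if there exists $V'\subseteq V$ with $|V'|=j$ such that $\chi(G-V'-E')\le k$, where $\chi$ is the chromatic number and $G-V'-E'$ is obtained from $G$ by deleting the vertices in $V'$ (with their incident edges) and the remaining edges of $E'$. The parameter $\chi_j^k(G)$ is the minimum of $|E'|$ over all such sets. For positive integers $m\ge k$, the Turán graph $T(m,k)$ is the complete $k$-partite graph on $m$ vertices whose parts have sizes differing by at most $1$, and $|T(m,k)|$ denotes its number of edges; writing $m=pk+q$ with $0\le q<k$, $|T(m,k)|=\binom{m}{2}-\left(q\binom{p+1}{2}+(k-q)\binom{p}{2}\right)$. -}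

module Defs where

open import Data.Nat using (ℕ; _+_; _*_; _∸_; _/_; _%_; NonZero)
open import Data.Nat.Combinatorics using (_C_)
open import Data.Fin using (Fin; toℕ)
open import Data.Fin.Subset using (Subset; _∈_; _∉_; ∣_∣)
open import Data.Product using (Σ; _×_; _,_; ∃-syntax)
open import Data.List using (List; length)
open import Data.List.Membership.Propositional renaming (_∈_ to _∈ₗ_; _∉_ to _∉ₗ_)
open import Data.List.Relation.Unary.All using (All)
open import Data.List.Relation.Unary.Unique.Propositional using (Unique)
open import Relation.Binary.PropositionalEquality using (_≡_)
open import Relation.Nullary using (¬_)
import Data.Nat as ℕ
open import Level using (0ℓ)

record SimpleGraph (n : ℕ) : Set₁ where
  field
    Adj       : Fin n → Fin n → Set
    symmetric : ∀ {u v} → Adj u v → Adj v u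
    irrefl    : ∀ {u} → ¬ Adj u u
open SimpleGraph public

complete : (n : ℕ) → SimpleGraph n
complete n = record
  { Adj = λ u v → ¬ (u ≡ v)
  ; symmetric = λ p q → p (Relation.Binary.PropositionalEquality.sym q)
  ; irrefl = λ p → p Relation.Binary.PropositionalEquality.refl
  }

-- An edge {u,v} is represented canonically by the ordered pair (u , v) with toℕ u < toℕ v.
IsEdge : ∀ {n} → SimpleGraph n → Fin n × Fin n → Set
IsEdge G (u , v) = (toℕ u ℕ.< toℕ v) × Adj G u v

record EdgeSet {n : ℕ} (G : SimpleGraph n) : Set where
  field
    edges  : List (Fin n × Fin n)
    ofG    : All (IsEdge G) edges
    unique : Unique edges
open EdgeSet public

size : ∀ {n} {G : SimpleGraph n} → EdgeSet G → ℕ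
size E' = length (edges E')

AdjRemoved : ∀ {n} (G : SimpleGraph n) → Subset n → EdgeSet G → Fin n → Fin n → Set
AdjRemoved G V' E' u v =
  Adj G u v × u ∉ V' × v ∉ V' × (u , v) ∉ₗ edges E' × (v , u) ∉ₗ edges E'

ChromaticAtMost : ∀ {n} (G : SimpleGraph n) → Subset n → EdgeSet G → ℕ → Set
ChromaticAtMost {n} G V' E' k =
  Σ (Fin n → Fin k) λ c → (∀ u v → AdjRemoved G V' E' u v → ¬ (c u ≡ c v))

IsMixedRemovalSet : ∀ {n} (G : SimpleGraph n) (k j : ℕ) → EdgeSet G → Set
IsMixedRemovalSet {n} G k j E' =
  Σ (Subset n) λ V' → (∣ V' ∣ ≡ j) × ChromaticAtMost G V' E' k

ChiMixed≡ : ∀ {n} (G : SimpleGraph n) (k j m : ℕ) → Set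
ChiMixed≡ G k j m =
  (Σ (EdgeSet G) λ E' → IsMixedRemovalSet G k j E' × size E' ≡ m)
  × (∀ (E' : EdgeSet G) → IsMixedRemovalSet G k j E' → m ℕ.≤ size E')

turanEdges : (m k : ℕ) → .{{NonZero k}} → ℕ
turanEdges m k = m C 2 ∸ (q * ((p + 1) C 2) + (k ∸ q) * (p C 2))
  where p = m / k
        q = m % k

{-# OPTIONS --safe #-}
-- Write n = j + m. Whatever j vertices are deleted, a proper k-colouring of what remains of K_n after
-- deleting E' puts the m survivors into classes of sizes a_x with Σ a_x = m, and every pair inside a
-- class must lie in E'. So |E'| ≥ Σ C(a_x,2) ≥ k C(p,2) + p q (p = m / k, q = m % k) by convexity of
-- C(·,2). Deleting the first j vertices, colouring the survivors by their index mod k and removing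
-- exactly the monochromatic pairs attains this bound, and k C(p,2) + p q = C(m,2) − |T(m,k)|.
-- When n ≤ k we have m = k and the bound is 0.
module Submission where

open import Defs
open import Data.Nat using (ℕ; zero; suc; _+_; _*_; _∸_; _≤_; _<_; _≡ᵇ_; _<ᵇ_; _/_; _%_; NonZero; z≤n; s≤s)
open import Data.Nat.Properties
  using ( +-*-semiring; +-comm; +-assoc; +-suc; +-identityʳ; *-identityʳ; *-zeroʳ; *-suc; *-comm
        ; +-mono-≤; +-monoʳ-≤; +-monoˡ-≤; *-monoˡ-≤; +-cancelʳ-≤; +-cancelˡ-≤; +-cancelʳ-≡
        ; m≤m+n; m≤n+m; m≤n*m; m+n∸m≡n; m∸[m∸n]≡n; m≤n⇒∃[o]m+o≡n
        ; ≤-refl; ≤-trans; ≤-antisym; ≤-total; <⇒≤; <-≤-trans; <-irrefl; <-asym; <-cmp; module ≤-Reasoning)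
open import Data.Nat.Combinatorics using (_C_; nCk+nC[k+1]≡[n+1]C[k+1]; nC1≡n)
open import Data.Nat.DivMod using (_mod_; n/n≡1; m%n<n; m≡m%n+[m/n]*n; m<n⇒m%n≡m; %-distribˡ-+; m%n%n≡m%n; n%n≡0; m*n%n≡0)
open import Data.Nat.Tactic.RingSolver using (solve-∀)
open import Data.Bool using (Bool; true; false; if_then_else_)
open import Data.Empty using (⊥-elim)
open import Data.Vec using ([]; _∷_)
import Data.Vec as Vec
open import Data.Fin.Subset using (Subset; inside; outside; ⊤; ⊥; _∉_; ∣_∣)
open import Data.Fin.Subset.Properties using (_∈?_; ∉⊥; ∣⊥∣≡0)
open import Data.Fin using (Fin; zero; suc; toℕ; _≟_)
open import Data.Product using (Σ; _×_; _,_; proj₁)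
open import Data.Sum using (_⊎_; inj₁; inj₂)
open import Data.Maybe using (Maybe; just; nothing)
open import Data.List using (List; []; _∷_; _++_; map; length)
open import Data.List.Properties using (length-map; length-++)
open import Data.List.Membership.Propositional using () renaming (_∈_ to _∈ₗ_; _∉_ to _∉ₗ_)
open import Data.List.Relation.Binary.Subset.Propositional using (_⊆_)
open import Data.List.Membership.Propositional.Properties using (∈-∃++; ∈-map⁺; ∈-map⁻; ∈-++⁺ˡ; ∈-++⁺ʳ; ∈-++⁻)
open import Data.List.Relation.Unary.Any using (here; there)
open import Data.List.Relation.Unary.All as All using (All; []; _∷_)
open import Data.List.Relation.Unary.AllPairs using ([]; _∷_)
open import Data.List.Relation.Unary.Unique.Propositional using (Unique)
import Data.List.Relation.Unary.Unique.Propositional.Properties as Uniqueₚ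
open import Data.Fin.Properties using (suc-injective; toℕ-injective; toℕ<n; toℕ-fromℕ<)
open import Data.Product.Properties using (≡-dec)
open import Relation.Binary.Definitions using (tri<; tri≈; tri>)
open import Relation.Nullary using (¬_; does; yes; no)
open import Relation.Nullary.Decidable using (dec-true)
open import Relation.Binary.PropositionalEquality
open import Function using (_∘_; case_of_)
open import Algebra.Properties.Semiring.Sum +-*-semiring
  using (sum; sum-syntax; sum-cong-≗; ∑-distrib-+; *-distribˡ-sum; *-distribʳ-sum; sum-replicate-zero)

[1+n]C2≡n+nC2 : ∀ n → suc n C 2 ≡ n + n C 2
[1+n]C2≡n+nC2 n = trans (sym (nCk+nC[k+1]≡[n+1]C[k+1] n 1)) (cong (_+ n C 2) (nC1≡n n))

[m+n]C2≡mC2+m*n+nC2 : ∀ m n → (m + n) C 2 ≡ m C 2 + m * n + n C 2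
[m+n]C2≡mC2+m*n+nC2 zero    n = refl
[m+n]C2≡mC2+m*n+nC2 (suc m) n = begin
  suc (m + n) C 2                     ≡⟨ [1+n]C2≡n+nC2 (m + n) ⟩
  (m + n) + (m + n) C 2               ≡⟨ cong ((m + n) +_) ([m+n]C2≡mC2+m*n+nC2 m n) ⟩
  (m + n) + (m C 2 + m * n + n C 2)   ≡⟨ regroup m n (m C 2) (n C 2) ⟩
  (m + m C 2) + (n + m * n) + n C 2   ≡⟨ cong (λ z → z + (n + m * n) + n C 2) ([1+n]C2≡n+nC2 m) ⟨
  suc m C 2 + suc m * n + n C 2       ∎
  where
  open ≡-Reasoning
  regroup : ∀ m n M N → (m + n) + (M + m * n + N) ≡ (m + M) + (n + m * n) + N
  regroup = solve-∀

nC2≤n*n : ∀ n → n C 2 ≤ n * n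
nC2≤n*n zero    = z≤n
nC2≤n*n (suc n) = begin
  suc n C 2         ≡⟨ [1+n]C2≡n+nC2 n ⟩
  n + n C 2         ≤⟨ +-monoʳ-≤ n (nC2≤n*n n) ⟩
  n + n * n         ≡⟨ *-suc n n ⟨
  n * suc n         ≤⟨ m≤n+m (n * suc n) (suc n) ⟩
  suc n * suc n     ∎
  where open ≤-Reasoning

-- The tangent line of a ↦ C(a,2) at p: C(a,2) ≥ C(p,2) + p (a − p).
pC2+p*a≤aC2+p*p : ∀ a p → p C 2 + p * a ≤ a C 2 + p * p
pC2+p*a≤aC2+p*p a p with ≤-total p a
... | inj₁ p≤a with d , refl ← m≤n⇒∃[o]m+o≡n p≤a = begin
  p C 2 + p * (p + d)               ≤⟨ m≤m+n _ (d C 2) ⟩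
  p C 2 + p * (p + d) + d C 2       ≡⟨ regroup (p C 2) (d C 2) p d ⟩
  p C 2 + p * d + d C 2 + p * p     ≡⟨ cong (_+ p * p) ([m+n]C2≡mC2+m*n+nC2 p d) ⟨
  (p + d) C 2 + p * p               ∎
  where
  open ≤-Reasoning
  regroup : ∀ P D p d → P + p * (p + d) + D ≡ P + p * d + D + p * p
  regroup = solve-∀
... | inj₂ a≤p with d , refl ← m≤n⇒∃[o]m+o≡n a≤p = begin
  (a + d) C 2 + (a + d) * a           ≡⟨ cong (_+ (a + d) * a) ([m+n]C2≡mC2+m*n+nC2 a d) ⟩
  a C 2 + a * d + d C 2 + (a + d) * a ≤⟨ +-monoˡ-≤ _ (+-monoʳ-≤ (a C 2 + a * d) (nC2≤n*n d)) ⟩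
  a C 2 + a * d + d * d + (a + d) * a ≡⟨ regroup (a C 2) a d ⟩
  a C 2 + (a + d) * (a + d)           ∎
  where
  open ≤-Reasoning
  regroup : ∀ A a d → A + a * d + d * d + (a + d) * a ≡ A + (a + d) * (a + d)
  regroup = solve-∀

m*nC2≤[m*n]C2 : ∀ m n → m * (n C 2) ≤ (m * n) C 2
m*nC2≤[m*n]C2 zero    n = z≤n
m*nC2≤[m*n]C2 (suc m) n = begin
  n C 2 + m * (n C 2)               ≤⟨ +-monoʳ-≤ (n C 2) (m*nC2≤[m*n]C2 m n) ⟩
  n C 2 + (m * n) C 2               ≤⟨ +-monoˡ-≤ _ (m≤m+n (n C 2) _) ⟩
  n C 2 + n * (m * n) + (m * n) C 2 ≡⟨ [m+n]C2≡mC2+m*n+nC2 n (m * n) ⟨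
  (n + m * n) C 2                   ∎
  where open ≤-Reasoning

𝟙 : Bool → ℕ
𝟙 true  = 1
𝟙 false = 0

[𝟙+n]C2≡𝟙*n+nC2 : ∀ b n → (𝟙 b + n) C 2 ≡ 𝟙 b * n + n C 2
[𝟙+n]C2≡𝟙*n+nC2 true  n = trans ([1+n]C2≡n+nC2 n) (cong (_+ n C 2) (sym (+-identityʳ n)))
[𝟙+n]C2≡𝟙*n+nC2 false n = refl

∑-const : ∀ n c → ∑[ i < n ] c ≡ n * c
∑-const zero    c = refl
∑-const (suc n) c = cong (c +_) (∑-const n c)

∑-mono-≤ : ∀ n {f g : Fin n → ℕ} → (∀ i → f i ≤ g i) → sum f ≤ sum g
∑-mono-≤ zero    f≤g = z≤n
∑-mono-≤ (suc n) f≤g = +-mono-≤ (f≤g zero) (∑-mono-≤ n (f≤g ∘ suc))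

∑-split : ∀ a b (g : ℕ → ℕ) →
  ∑[ i < a + b ] g (toℕ i) ≡ ∑[ i < a ] g (toℕ i) + ∑[ i < b ] g (a + toℕ i)
∑-split zero    b g = refl
∑-split (suc a) b g = trans (cong (g 0 +_) (∑-split a b (g ∘ suc))) (sym (+-assoc (g 0) _ _))

∑-δ : ∀ {k} (y : Fin k) (f : Fin k → ℕ) → ∑[ x < k ] (𝟙 (does (x ≟ y)) * f x) ≡ f y
∑-δ {suc k} zero    f = trans (cong (f zero + 0 +_) (sum-replicate-zero k)) (trans (+-identityʳ _) (+-identityʳ _))
∑-δ {suc k} (suc y) f = ∑-δ y (f ∘ suc)

∑-δ-const : ∀ {k} (y : Fin k) → ∑[ x < k ] 𝟙 (does (x ≟ y)) ≡ 1
∑-δ-const {k} y = trans (sum-cong-≗ {k} (λ x → sym (*-identityʳ (𝟙 (does (x ≟ y)))))) (∑-δ y (λ _ → 1))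

∑-≡ᵇ : ∀ b t → ∑[ i < b ] 𝟙 (t ≡ᵇ toℕ i) ≡ 𝟙 (t <ᵇ b)
∑-≡ᵇ zero    t       = refl
∑-≡ᵇ (suc b) zero    = cong suc (sum-replicate-zero b)
∑-≡ᵇ (suc b) (suc t) = ∑-≡ᵇ b t

𝟙-<ᵇ : ∀ {t b} → t < b → 𝟙 (t <ᵇ b) ≡ 1
𝟙-<ᵇ {zero}  {suc b} _         = refl
𝟙-<ᵇ {suc t} {suc b} (s≤s t<b) = 𝟙-<ᵇ t<b

does-≟≡toℕ-≡ᵇ : ∀ {n} (x y : Fin n) → does (x ≟ y) ≡ (toℕ x ≡ᵇ toℕ y)
does-≟≡toℕ-≡ᵇ zero    zero    = refl
does-≟≡toℕ-≡ᵇ zero    (suc y) = refl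
does-≟≡toℕ-≡ᵇ (suc x) zero    = refl
does-≟≡toℕ-≡ᵇ (suc x) (suc y) = does-≟≡toℕ-≡ᵇ x y

∑-<ᵇ : ∀ {k q} → q ≤ k → ∑[ x < k ] 𝟙 (toℕ x <ᵇ q) ≡ q
∑-<ᵇ {k} {zero}      _         = sum-replicate-zero k
∑-<ᵇ {suc k} {suc q} (s≤s q≤k) = cong suc (∑-<ᵇ q≤k)

PartialColouring : ℕ → ℕ → Set
PartialColouring n k = Fin n → Maybe (Fin k)

_hasColour_ : ∀ {k} → Maybe (Fin k) → Fin k → Bool
nothing hasColour x = false
just y  hasColour x = does (x ≟ y)

hasColour⇒≡just : ∀ {k} (m : Maybe (Fin k)) x → m hasColour x ≡ true → m ≡ just x
hasColour⇒≡just (just y) x eq with x ≟ y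
hasColour⇒≡just (just y) x eq | yes refl = refl
hasColour⇒≡just (just y) x () | no _

≡just⇒hasColour : ∀ {k} {m : Maybe (Fin k)} {x} → m ≡ just x → m hasColour x ≡ true
≡just⇒hasColour {x = x} refl = dec-true (x ≟ x) refl

prependIf : ∀ {A : Set} → Bool → A → List A → List A
prependIf true  a as = a ∷ as
prependIf false a as = as

length-prependIf : ∀ {A : Set} b (a : A) as → length (prependIf b a as) ≡ 𝟙 b + length as
length-prependIf true  a as = refl
length-prependIf false a as = refl

∈-prependIf⁻ : ∀ {A : Set} b {a v : A} {as} → v ∈ₗ prependIf b a as → (b ≡ true × v ≡ a) ⊎ v ∈ₗ as
∈-prependIf⁻ true  (here v≡a) = inj₁ (refl , v≡a)
∈-prependIf⁻ true  (there v∈) = inj₂ v∈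
∈-prependIf⁻ false v∈         = inj₂ v∈

∈-prependIf⁺ʳ : ∀ {A : Set} b {a v : A} {as} → v ∈ₗ as → v ∈ₗ prependIf b a as
∈-prependIf⁺ʳ true  v∈ = there v∈
∈-prependIf⁺ʳ false v∈ = v∈

prependIf-unique : ∀ {A : Set} b {a : A} {as} → All (a ≢_) as → Unique as → Unique (prependIf b a as)
prependIf-unique true  a∉ u = a∉ ∷ u
prependIf-unique false a∉ u = u

module _ {k : ℕ} where

  classSize : ∀ {n} → PartialColouring n k → Fin k → ℕ
  classSize {n} χ x = ∑[ u < n ] 𝟙 (χ u hasColour x)

  colourClass : ∀ {n} → PartialColouring n k → Fin k → List (Fin n)
  colourClass {zero}  χ x = []
  colourClass {suc n} χ x = prependIf (χ zero hasColour x) zero (map suc (colourClass (χ ∘ suc) x))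

  length-colourClass : ∀ {n} (χ : PartialColouring n k) x → length (colourClass χ x) ≡ classSize χ x
  length-colourClass {zero}  χ x = refl
  length-colourClass {suc n} χ x = begin
    length (colourClass χ x)                                 ≡⟨ length-prependIf (χ zero hasColour x) zero _ ⟩
    𝟙 (χ zero hasColour x) + length (map suc (colourClass (χ ∘ suc) x))
      ≡⟨ cong (𝟙 (χ zero hasColour x) +_) (trans (length-map suc (colourClass (χ ∘ suc) x)) (length-colourClass (χ ∘ suc) x)) ⟩
    classSize χ x                                            ∎
    where open ≡-Reasoning

  ∈-colourClass⁻ : ∀ {n} (χ : PartialColouring n k) x {u} → u ∈ₗ colourClass χ x → χ u ≡ just x
  ∈-colourClass⁻ {suc n} χ x u∈ with ∈-prependIf⁻ (χ zero hasColour x) u∈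
  ... | inj₁ (eq , refl) = hasColour⇒≡just (χ zero) x eq
  ... | inj₂ u∈′ with v , v∈ , refl ← ∈-map⁻ suc u∈′ = ∈-colourClass⁻ (χ ∘ suc) x v∈

  ∈-colourClass⁺ : ∀ {n} (χ : PartialColouring n k) x {u} → χ u ≡ just x → u ∈ₗ colourClass χ x
  ∈-colourClass⁺ {suc n} χ x {zero}  eq rewrite ≡just⇒hasColour eq = here refl
  ∈-colourClass⁺ {suc n} χ x {suc u} eq =
    ∈-prependIf⁺ʳ (χ zero hasColour x) (∈-map⁺ suc (∈-colourClass⁺ (χ ∘ suc) x eq))

  colourClass-unique : ∀ {n} (χ : PartialColouring n k) x → Unique (colourClass χ x)
  colourClass-unique {zero}  χ x = []
  colourClass-unique {suc n} χ x =
    prependIf-unique (χ zero hasColour x) zero∉ (Uniqueₚ.map⁺ suc-injective (colourClass-unique (χ ∘ suc) x))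
    where
    zero∉ : All (zero ≢_) (map suc (colourClass (χ ∘ suc) x))
    zero∉ = All.tabulate λ v∈ → case ∈-map⁻ suc v∈ of λ { (_ , _ , refl) () }

  classmates : ∀ {n} → Maybe (Fin k) → PartialColouring n k → List (Fin n)
  classmates nothing  χ = []
  classmates (just y) χ = colourClass χ y

  length-classmates : ∀ {n} m (χ : PartialColouring n k) →
    length (classmates m χ) ≡ ∑[ x < k ] (𝟙 (m hasColour x) * classSize χ x)
  length-classmates nothing  χ = sym (sum-replicate-zero k)
  length-classmates (just y) χ = trans (length-colourClass χ y) (sym (∑-δ y (classSize χ)))

  ∈-classmates⁻ : ∀ {n} m (χ : PartialColouring n k) {v} → v ∈ₗ classmates m χ →
    Σ (Fin k) λ x → m ≡ just x × χ v ≡ just x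
  ∈-classmates⁻ (just y) χ v∈ = y , refl , ∈-colourClass⁻ χ y v∈

  classmates-unique : ∀ {n} m (χ : PartialColouring n k) → Unique (classmates m χ)
  classmates-unique nothing  χ = []
  classmates-unique (just y) χ = colourClass-unique χ y

  sucPair : ∀ {n} → Fin n × Fin n → Fin (suc n) × Fin (suc n)
  sucPair (u , v) = suc u , suc v

  monochromaticPairs : ∀ {n} → PartialColouring n k → List (Fin n × Fin n)
  monochromaticPairs {zero}  χ = []
  monochromaticPairs {suc n} χ =
    map (λ v → zero , suc v) (classmates (χ zero) (χ ∘ suc)) ++ map sucPair (monochromaticPairs (χ ∘ suc))

  length-monochromaticPairs : ∀ {n} (χ : PartialColouring n k) →
    length (monochromaticPairs χ) ≡ ∑[ x < k ] (classSize χ x C 2)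
  length-monochromaticPairs {zero}  χ = sym (sum-replicate-zero k)
  length-monochromaticPairs {suc n} χ = begin
    length (map (λ v → zero , suc v) (classmates (χ zero) χ′) ++ map sucPair (monochromaticPairs χ′))
      ≡⟨ length-++ (map (λ v → zero , suc v) (classmates (χ zero) χ′)) ⟩
    length (map (λ v → zero , suc v) (classmates (χ zero) χ′)) + length (map sucPair (monochromaticPairs χ′))
      ≡⟨ cong₂ _+_ (length-map _ (classmates (χ zero) χ′)) (length-map sucPair (monochromaticPairs χ′)) ⟩
    length (classmates (χ zero) χ′) + length (monochromaticPairs χ′)
      ≡⟨ cong₂ _+_ (length-classmates (χ zero) χ′) (length-monochromaticPairs χ′) ⟩
    ∑[ x < k ] (𝟙 (χ zero hasColour x) * classSize χ′ x) + ∑[ x < k ] (classSize χ′ x C 2)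
      ≡⟨ ∑-distrib-+ (λ x → 𝟙 (χ zero hasColour x) * classSize χ′ x) (λ x → classSize χ′ x C 2) ⟨
    ∑[ x < k ] (𝟙 (χ zero hasColour x) * classSize χ′ x + classSize χ′ x C 2)
      ≡⟨ sum-cong-≗ {k} (λ x → [𝟙+n]C2≡𝟙*n+nC2 (χ zero hasColour x) (classSize χ′ x)) ⟨
    ∑[ x < k ] (classSize χ x C 2) ∎
    where
    open ≡-Reasoning
    χ′ = χ ∘ suc

  ∈-monochromaticPairs⁻ : ∀ {n} (χ : PartialColouring n k) {u v} → (u , v) ∈ₗ monochromaticPairs χ →
    toℕ u < toℕ v × Σ (Fin k) λ x → χ u ≡ just x × χ v ≡ just x
  ∈-monochromaticPairs⁻ {suc n} χ uv∈ with ∈-++⁻ (map (λ v → zero , suc v) (classmates (χ zero) (χ ∘ suc))) uv∈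
  ... | inj₁ uv∈₁ with w , w∈ , refl ← ∈-map⁻ _ uv∈₁
    = s≤s z≤n , ∈-classmates⁻ (χ zero) (χ ∘ suc) w∈
  ... | inj₂ uv∈₂ with (a , b) , ab∈ , refl ← ∈-map⁻ sucPair uv∈₂
    with a<b , x , χa , χb ← ∈-monochromaticPairs⁻ (χ ∘ suc) ab∈
    = s≤s a<b , x , χa , χb

  ∈-monochromaticPairs⁺ : ∀ {n} (χ : PartialColouring n k) {u v x} →
    toℕ u < toℕ v → χ u ≡ just x → χ v ≡ just x → (u , v) ∈ₗ monochromaticPairs χ
  ∈-monochromaticPairs⁺ {suc n} χ {zero} {suc v} {x} _ χu χv rewrite χu =
    ∈-++⁺ˡ (∈-map⁺ (λ v → zero , suc v) (∈-colourClass⁺ (χ ∘ suc) x χv))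
  ∈-monochromaticPairs⁺ {suc n} χ {suc u} {suc v} (s≤s u<v) χu χv =
    ∈-++⁺ʳ _ (∈-map⁺ sucPair (∈-monochromaticPairs⁺ (χ ∘ suc) u<v χu χv))

  monochromaticPairs-unique : ∀ {n} (χ : PartialColouring n k) → Unique (monochromaticPairs χ)
  monochromaticPairs-unique {zero}  χ = []
  monochromaticPairs-unique {suc n} χ = Uniqueₚ.++⁺
    (Uniqueₚ.map⁺ (λ { refl → refl }) (classmates-unique (χ zero) (χ ∘ suc)))
    (Uniqueₚ.map⁺ (λ { {_ , _} {_ , _} refl → refl }) (monochromaticPairs-unique (χ ∘ suc)))
    firstRow∩shifted≡∅
    where
    firstRow∩shifted≡∅ : ∀ {e} → ¬ (e ∈ₗ map (λ v → zero , suc v) (classmates (χ zero) (χ ∘ suc))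
                                   × e ∈ₗ map sucPair (monochromaticPairs (χ ∘ suc)))
    firstRow∩shifted≡∅ (e∈₁ , e∈₂) with _ , _ , refl ← ∈-map⁻ _ e∈₁ | _ , _ , () ← ∈-map⁻ sucPair e∈₂

Unique∧⊆⇒length≤ : ∀ {A : Set} (xs ys : List A) → Unique xs → xs ⊆ ys → length xs ≤ length ys
Unique∧⊆⇒length≤ []       ys _            _      = z≤n
Unique∧⊆⇒length≤ (x ∷ xs) ys (x∉xs ∷ uxs) xs⊆ys with as , bs , refl ← ∈-∃++ (xs⊆ys (here refl)) = begin
  suc (length xs)              ≤⟨ s≤s (Unique∧⊆⇒length≤ xs (as ++ bs) uxs xs⊆as++bs) ⟩
  suc (length (as ++ bs))      ≡⟨ cong suc (length-++ as) ⟩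
  suc (length as + length bs)  ≡⟨ +-suc (length as) (length bs) ⟨
  length as + length (x ∷ bs)  ≡⟨ length-++ as ⟨
  length (as ++ x ∷ bs)        ∎
  where
  open ≤-Reasoning
  xs⊆as++bs : xs ⊆ as ++ bs
  xs⊆as++bs z∈xs with ∈-++⁻ as (xs⊆ys (there z∈xs))
  ... | inj₁ z∈as         = ∈-++⁺ˡ z∈as
  ... | inj₂ (here refl)  = ⊥-elim (All.lookup x∉xs z∈xs refl)
  ... | inj₂ (there z∈bs) = ∈-++⁺ʳ as z∈bs

erase : ∀ {n k} → Subset n → (Fin n → Fin k) → PartialColouring n k
erase V c u = if does (u ∈? V) then nothing else just (c u)

erase-∉ : ∀ {n k} (V : Subset n) (c : Fin n → Fin k) {u} → u ∉ V → erase V c u ≡ just (c u)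
erase-∉ V c {u} u∉V with u ∈? V
... | yes u∈V = ⊥-elim (u∉V u∈V)
... | no  _   = refl

erase≡just⇒ : ∀ {n k} (V : Subset n) (c : Fin n → Fin k) {u x} → erase V c u ≡ just x → u ∉ V × c u ≡ x
erase≡just⇒ V c {u} eq with u ∈? V
erase≡just⇒ V c ()   | yes _
erase≡just⇒ V c refl | no u∉V = u∉V , refl

∑-classSize-erase : ∀ {n k} (V : Subset n) (c : Fin n → Fin k) →
  ∑[ x < k ] classSize (erase V c) x + ∣ V ∣ ≡ n
∑-classSize-erase {zero}  {k} []              c = trans (+-identityʳ _) (sum-replicate-zero k)
∑-classSize-erase {suc n} {k} (inside  ∷ V) c = trans (+-suc _ ∣ V ∣) (cong suc (∑-classSize-erase V (c ∘ suc)))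
∑-classSize-erase {suc n} {k} (outside ∷ V) c = begin
  ∑[ x < k ] (𝟙 (does (x ≟ c zero)) + classSize (erase V (c ∘ suc)) x) + ∣ V ∣
    ≡⟨ cong (_+ ∣ V ∣) (∑-distrib-+ (λ x → 𝟙 (does (x ≟ c zero))) (classSize (erase V (c ∘ suc)))) ⟩
  ∑[ x < k ] 𝟙 (does (x ≟ c zero)) + ∑[ x < k ] classSize (erase V (c ∘ suc)) x + ∣ V ∣
    ≡⟨ cong (λ s → s + ∑[ x < k ] classSize (erase V (c ∘ suc)) x + ∣ V ∣) (∑-δ-const (c zero)) ⟩
  suc (∑[ x < k ] classSize (erase V (c ∘ suc)) x + ∣ V ∣)
    ≡⟨ cong suc (∑-classSize-erase V (c ∘ suc)) ⟩
  suc n ∎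
  where open ≡-Reasoning

-- With p = m / k and q = m % k, a balanced colouring has q classes of size p + 1 and k − q of size p,
-- hence q C(p+1,2) + (k − q) C(p,2) = k C(p,2) + p q monochromatic pairs.
balancedMonochromatic : (k m : ℕ) .{{_ : NonZero k}} → ℕ
balancedMonochromatic k m = k * (m / k C 2) + m / k * (m % k)

module _ {k : ℕ} .{{_ : NonZero k}} where

  private
    turanNonEdges≡balanced : ∀ m →
      m % k * ((m / k + 1) C 2) + (k ∸ m % k) * (m / k C 2) ≡ balancedMonochromatic k m
    turanNonEdges≡balanced m with r , q+r≡k ← m≤n⇒∃[o]m+o≡n (<⇒≤ (m%n<n m k)) = begin
      q * ((p + 1) C 2) + (k ∸ q) * (p C 2)
        ≡⟨ cong₂ (λ a b → q * a + b * (p C 2)) (trans (cong (_C 2) (+-comm p 1)) ([1+n]C2≡n+nC2 p))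
                                                (trans (cong (_∸ q) (sym q+r≡k)) (m+n∸m≡n q r)) ⟩
      q * (p + p C 2) + r * (p C 2)      ≡⟨ regroup q p (p C 2) r ⟩
      (q + r) * (p C 2) + p * q          ≡⟨ cong (λ z → z * (p C 2) + p * q) q+r≡k ⟩
      k * (p C 2) + p * q                ∎
      where
      open ≡-Reasoning
      p = m / k
      q = m % k
      regroup : ∀ q p P r → q * (p + P) + r * P ≡ (q + r) * P + p * q
      regroup = solve-∀

    balanced≤mC2 : ∀ m → balancedMonochromatic k m ≤ m C 2
    balanced≤mC2 m = begin
      k * (p C 2) + p * q               ≤⟨ +-mono-≤ (m*nC2≤[m*n]C2 k p) (*-monoˡ-≤ q (m≤n*m p k)) ⟩
      (k * p) C 2 + (k * p) * q         ≤⟨ m≤m+n _ (q C 2) ⟩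
      (k * p) C 2 + (k * p) * q + q C 2 ≡⟨ [m+n]C2≡mC2+m*n+nC2 (k * p) q ⟨
      (k * p + q) C 2                   ≡⟨ cong (_C 2) k*p+q≡m ⟩
      m C 2                             ∎
      where
      open ≤-Reasoning
      p = m / k
      q = m % k
      k*p+q≡m : k * p + q ≡ m
      k*p+q≡m = trans (+-comm (k * p) q) (trans (cong (q +_) (*-comm k p)) (sym (m≡m%n+[m/n]*n m k)))

  balancedMonochromatic-k-k≡0 : balancedMonochromatic k k ≡ 0
  balancedMonochromatic-k-k≡0 =
    trans (cong₂ (λ p q → k * (p C 2) + p * q) (n/n≡1 k) (n%n≡0 k)) (trans (+-identityʳ _) (*-zeroʳ k))

  mC2∸turanEdges≡balanced : ∀ m → m C 2 ∸ turanEdges m k ≡ balancedMonochromatic k m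
  mC2∸turanEdges≡balanced m =
    trans (cong (λ z → m C 2 ∸ (m C 2 ∸ z)) (turanNonEdges≡balanced m)) (m∸[m∸n]≡n (balanced≤mC2 m))

  -- Jensen for the convex a ↦ C(a,2): sum the tangent-line bound at p = ⌊m/k⌋ over the k classes.
  balanced≤∑C2 : ∀ (a : Fin k → ℕ) m → ∑[ x < k ] a x ≡ m → balancedMonochromatic k m ≤ ∑[ x < k ] (a x C 2)
  balanced≤∑C2 a m ∑a≡m = +-cancelʳ-≤ (k * (p * p)) _ _ (begin
    k * (p C 2) + p * q + k * (p * p)            ≡⟨ regroup k (p C 2) q p ⟩
    k * (p C 2) + p * (q + p * k)                ≡⟨ cong (λ z → k * (p C 2) + p * z) (sym (trans ∑a≡m (m≡m%n+[m/n]*n m k))) ⟩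
    k * (p C 2) + p * ∑[ x < k ] a x             ≡⟨ cong₂ _+_ (∑-const k (p C 2)) (sym (*-distribˡ-sum p a)) ⟨
    ∑[ x < k ] (p C 2) + ∑[ x < k ] (p * a x)    ≡⟨ ∑-distrib-+ (λ _ → p C 2) (λ x → p * a x) ⟨
    ∑[ x < k ] (p C 2 + p * a x)                 ≤⟨ ∑-mono-≤ k (λ x → pC2+p*a≤aC2+p*p (a x) p) ⟩
    ∑[ x < k ] (a x C 2 + p * p)                 ≡⟨ ∑-distrib-+ (λ x → a x C 2) (λ _ → p * p) ⟩
    ∑[ x < k ] (a x C 2) + ∑[ x < k ] (p * p)    ≡⟨ cong (∑[ x < k ] (a x C 2) +_) (∑-const k (p * p)) ⟩
    ∑[ x < k ] (a x C 2) + k * (p * p)           ∎)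
    where
    open ≤-Reasoning
    p = m / k
    q = m % k
    regroup : ∀ k P q p → k * P + p * q + k * (p * p) ≡ k * P + p * (q + p * k)
    regroup = solve-∀

  private
    ∑-residue-short : ∀ t b → b ≤ k → ∑[ i < b ] 𝟙 (t ≡ᵇ toℕ i % k) ≡ 𝟙 (t <ᵇ b)
    ∑-residue-short t b b≤k =
      trans (sum-cong-≗ {b} (λ i → cong (λ r → 𝟙 (t ≡ᵇ r)) (m<n⇒m%n≡m (<-≤-trans (toℕ<n i) b≤k)))) (∑-≡ᵇ b t)

    ∑-residue-shift : ∀ t a b → a % k ≡ 0 → ∑[ i < b ] 𝟙 (t ≡ᵇ (a + toℕ i) % k) ≡ ∑[ i < b ] 𝟙 (t ≡ᵇ toℕ i % k)
    ∑-residue-shift t a b a%k≡0 = sum-cong-≗ {b} λ i → cong (λ r → 𝟙 (t ≡ᵇ r)) (begin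
      (a + toℕ i) % k          ≡⟨ %-distribˡ-+ a (toℕ i) k ⟩
      (a % k + toℕ i % k) % k  ≡⟨ cong (λ r → (r + toℕ i % k) % k) a%k≡0 ⟩
      toℕ i % k % k            ≡⟨ m%n%n≡m%n (toℕ i) k ⟩
      toℕ i % k                ∎)
      where open ≡-Reasoning

    ∑-residue-periods : ∀ t → t < k → ∀ p → ∑[ i < p * k ] 𝟙 (t ≡ᵇ toℕ i % k) ≡ p
    ∑-residue-periods t t<k zero    = refl
    ∑-residue-periods t t<k (suc p) = begin
      ∑[ i < k + p * k ] 𝟙 (t ≡ᵇ toℕ i % k)
        ≡⟨ ∑-split k (p * k) (λ i → 𝟙 (t ≡ᵇ i % k)) ⟩
      ∑[ i < k ] 𝟙 (t ≡ᵇ toℕ i % k) + ∑[ i < p * k ] 𝟙 (t ≡ᵇ (k + toℕ i) % k)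
        ≡⟨ cong₂ _+_ (∑-residue-short t k ≤-refl) (∑-residue-shift t k (p * k) (n%n≡0 k)) ⟩
      𝟙 (t <ᵇ k) + ∑[ i < p * k ] 𝟙 (t ≡ᵇ toℕ i % k)
        ≡⟨ cong₂ _+_ (𝟙-<ᵇ t<k) (∑-residue-periods t t<k p) ⟩
      suc p ∎
      where open ≡-Reasoning

  classSize-mod : ∀ m (x : Fin k) → classSize (λ (i : Fin m) → just (toℕ i mod k)) x ≡ m / k + 𝟙 (toℕ x <ᵇ m % k)
  classSize-mod m x = begin
    ∑[ i < m ] 𝟙 (does (x ≟ toℕ i mod k))
      ≡⟨ sum-cong-≗ {m} (λ i → cong 𝟙 (trans (does-≟≡toℕ-≡ᵇ x (toℕ i mod k)) (cong (t ≡ᵇ_) (toℕ-fromℕ< _)))) ⟩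
    ∑[ i < m ] 𝟙 (t ≡ᵇ toℕ i % k)
      ≡⟨ cong (λ n → ∑[ i < n ] 𝟙 (t ≡ᵇ toℕ i % k)) m≡p*k+q ⟩
    ∑[ i < p * k + q ] 𝟙 (t ≡ᵇ toℕ i % k)
      ≡⟨ ∑-split (p * k) q (λ i → 𝟙 (t ≡ᵇ i % k)) ⟩
    ∑[ i < p * k ] 𝟙 (t ≡ᵇ toℕ i % k) + ∑[ i < q ] 𝟙 (t ≡ᵇ (p * k + toℕ i) % k)
      ≡⟨ cong₂ _+_ (∑-residue-periods t (toℕ<n x) p) (∑-residue-shift t (p * k) q (m*n%n≡0 p k)) ⟩
    p + ∑[ i < q ] 𝟙 (t ≡ᵇ toℕ i % k)
      ≡⟨ cong (p +_) (∑-residue-short t q (<⇒≤ (m%n<n m k))) ⟩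
    p + 𝟙 (t <ᵇ q) ∎
    where
    open ≡-Reasoning
    p = m / k
    q = m % k
    t = toℕ x
    m≡p*k+q : m ≡ p * k + q
    m≡p*k+q = trans (m≡m%n+[m/n]*n m k) (+-comm q (p * k))

  ∑C2-classSize-mod : ∀ m → ∑[ x < k ] ((m / k + 𝟙 (toℕ x <ᵇ m % k)) C 2) ≡ balancedMonochromatic k m
  ∑C2-classSize-mod m = begin
    ∑[ x < k ] ((p + 𝟙 (b x)) C 2)
      ≡⟨ sum-cong-≗ {k} (λ x → trans (cong (_C 2) (+-comm p (𝟙 (b x)))) ([𝟙+n]C2≡𝟙*n+nC2 (b x) p)) ⟩
    ∑[ x < k ] (𝟙 (b x) * p + p C 2)
      ≡⟨ ∑-distrib-+ (λ x → 𝟙 (b x) * p) (λ _ → p C 2) ⟩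
    ∑[ x < k ] (𝟙 (b x) * p) + ∑[ x < k ] (p C 2)
      ≡⟨ cong₂ _+_ (*-distribʳ-sum p (λ x → 𝟙 (b x))) (sym (∑-const k (p C 2))) ⟨
    ∑[ x < k ] 𝟙 (b x) * p + k * (p C 2)
      ≡⟨ cong (λ s → s * p + k * (p C 2)) (∑-<ᵇ (<⇒≤ (m%n<n m k))) ⟩
    q * p + k * (p C 2)
      ≡⟨ trans (+-comm (q * p) _) (cong (k * (p C 2) +_) (*-comm q p)) ⟩
    k * (p C 2) + p * q ∎
    where
    open ≡-Reasoning
    p = m / k
    q = m % k
    b : Fin k → Bool
    b x = toℕ x <ᵇ q

module _ {n k : ℕ} (V : Subset n) (c : Fin n → Fin k) where

  open import Data.List.Membership.DecPropositional (≡-dec (_≟_ {n}) (_≟_ {n})) using () renaming (_∈?_ to _∈ₗ?_)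

  monochromaticEdges : EdgeSet (complete n)
  monochromaticEdges = record
    { edges  = monochromaticPairs (erase V c)
    ; ofG    = All.tabulate λ uv∈ → let u<v = proj₁ (∈-monochromaticPairs⁻ (erase V c) uv∈) in
                 u<v , λ u≡v → <-irrefl (cong toℕ u≡v) u<v
    ; unique = monochromaticPairs-unique (erase V c)
    }

  size-monochromaticEdges : size monochromaticEdges ≡ ∑[ x < k ] (classSize (erase V c) x C 2)
  size-monochromaticEdges = length-monochromaticPairs (erase V c)

  monochromaticEdges-proper : ∀ u v → AdjRemoved (complete n) V monochromaticEdges u v → c u ≢ c v
  monochromaticEdges-proper u v (u≢v , u∉V , v∉V , uv∉E , vu∉E) cu≡cv with <-cmp (toℕ u) (toℕ v)
  ... | tri< u<v _ _ = uv∉E (∈-monochromaticPairs⁺ (erase V c) u<v χu χv)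
    where χu = erase-∉ V c u∉V
          χv = trans (erase-∉ V c v∉V) (cong just (sym cu≡cv))
  ... | tri≈ _ u≡v _ = u≢v (toℕ-injective u≡v)
  ... | tri> _ _ v<u = vu∉E (∈-monochromaticPairs⁺ (erase V c) v<u χv χu)
    where χu = trans (erase-∉ V c u∉V) (cong just cu≡cv)
          χv = erase-∉ V c v∉V

  monochromaticEdges⊆ : (E : EdgeSet (complete n)) → (∀ u v → AdjRemoved (complete n) V E u v → c u ≢ c v) →
    edges monochromaticEdges ⊆ edges E
  monochromaticEdges⊆ E proper {a , b} ab∈M
    with a<b , x , χa , χb ← ∈-monochromaticPairs⁻ (erase V c) ab∈M
    with a∉V , ca≡x ← erase≡just⇒ V c χa | b∉V , cb≡x ← erase≡just⇒ V c χb
    with (a , b) ∈ₗ? edges E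
  ... | yes ab∈E = ab∈E
  ... | no  ab∉E = ⊥-elim (proper a b (a≢b , a∉V , b∉V , ab∉E , ba∉E) (trans ca≡x (sym cb≡x)))
    where
    a≢b : a ≢ b
    a≢b a≡b = <-irrefl (cong toℕ a≡b) a<b
    ba∉E : (b , a) ∉ₗ edges E
    ba∉E ba∈E = <-asym a<b (proj₁ (All.lookup (ofG E) ba∈E))

∣⊤++⊥∣≡ : ∀ j m → ∣ ⊤ {j} Vec.++ ⊥ {m} ∣ ≡ j
∣⊤++⊥∣≡ zero    m = ∣⊥∣≡0 m
∣⊤++⊥∣≡ (suc j) m = cong suc (∣⊤++⊥∣≡ j m)

classSize-erase-⊤++⊥ : ∀ {k} j m (g : ℕ → Fin k) x →
  classSize (erase (⊤ {j} Vec.++ ⊥ {m}) (λ u → g (toℕ u ∸ j))) x ≡ classSize (λ (i : Fin m) → just (g (toℕ i))) x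
classSize-erase-⊤++⊥ zero    m g x = sum-cong-≗ {m} λ i → cong (λ χi → 𝟙 (χi hasColour x)) (erase-∉ ⊥ (g ∘ toℕ) ∉⊥)
classSize-erase-⊤++⊥ (suc j) m g x = classSize-erase-⊤++⊥ j m g x

module _ {k : ℕ} .{{_ : NonZero k}} where

  balanced≤size : ∀ j m (E : EdgeSet (complete (j + m))) → IsMixedRemovalSet (complete (j + m)) k j E →
    balancedMonochromatic k m ≤ size E
  balanced≤size j m E (V , ∣V∣≡j , c , proper) = begin
    balancedMonochromatic k m                      ≤⟨ balanced≤∑C2 (classSize (erase V c)) m ∑classSize≡m ⟩
    ∑[ x < k ] (classSize (erase V c) x C 2)       ≡⟨ size-monochromaticEdges V c ⟨
    size (monochromaticEdges V c)                  ≤⟨ Unique∧⊆⇒length≤ _ (edges E) (unique (monochromaticEdges V c))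
                                                                          (monochromaticEdges⊆ V c E proper) ⟩
    size E                                         ∎
    where
    open ≤-Reasoning
    ∑classSize≡m : ∑[ x < k ] classSize (erase V c) x ≡ m
    ∑classSize≡m = +-cancelʳ-≡ j _ m
      (trans (cong (∑[ x < k ] classSize (erase V c) x +_) (sym ∣V∣≡j))
             (trans (∑-classSize-erase V c) (+-comm j m)))

  balancedRemovalSet : ∀ j m → Σ (EdgeSet (complete (j + m))) λ E →
    IsMixedRemovalSet (complete (j + m)) k j E × size E ≡ balancedMonochromatic k m
  balancedRemovalSet j m = monochromaticEdges V c , (V , ∣⊤++⊥∣≡ j m , c , monochromaticEdges-proper V c) , size≡
    where
    V = ⊤ {j} Vec.++ ⊥ {m}
    c : Fin (j + m) → Fin k
    c u = (toℕ u ∸ j) mod k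
    size≡ : size (monochromaticEdges V c) ≡ balancedMonochromatic k m
    size≡ = begin
      size (monochromaticEdges V c)                              ≡⟨ size-monochromaticEdges V c ⟩
      ∑[ x < k ] (classSize (erase V c) x C 2)
        ≡⟨ sum-cong-≗ {k} (λ x → cong (_C 2) (trans (classSize-erase-⊤++⊥ j m (_mod k) x) (classSize-mod m x))) ⟩
      ∑[ x < k ] ((m / k + 𝟙 (toℕ x <ᵇ m % k)) C 2)             ≡⟨ ∑C2-classSize-mod m ⟩
      balancedMonochromatic k m                                  ∎
      where open ≡-Reasoning

  chiMixed-complete : ∀ j m → ChiMixed≡ (complete (j + m)) k j (balancedMonochromatic k m)
  chiMixed-complete j m = balancedRemovalSet j m , balanced≤size j m

mainTheorem10 : (n k j : ℕ) → .{{_ : NonZero k}} → j + k ≤ n →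
    (n ≤ k → ChiMixed≡ (complete n) k j 0)
    × (k < n → ChiMixed≡ (complete n) k j ((n ∸ j) C 2 ∸ turanEdges (n ∸ j) k))
mainTheorem10 n k j j+k≤n with m , refl ← m≤n⇒∃[o]m+o≡n (≤-trans (m≤m+n j k) j+k≤n) =
  (λ j+m≤k → subst (ChiMixed≡ (complete (j + m)) k j) (balanced≡0 j+m≤k) (chiMixed-complete j m)) ,
  (λ _ → subst (ChiMixed≡ (complete (j + m)) k j) (sym target≡balanced) (chiMixed-complete j m))
  where
  target≡balanced : (j + m ∸ j) C 2 ∸ turanEdges (j + m ∸ j) k ≡ balancedMonochromatic k m
  target≡balanced = trans (cong (λ m′ → m′ C 2 ∸ turanEdges m′ k) (m+n∸m≡n j m)) (mC2∸turanEdges≡balanced m)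
  balanced≡0 : j + m ≤ k → balancedMonochromatic k m ≡ 0
  balanced≡0 j+m≤k with refl ← ≤-antisym (≤-trans (m≤n+m m j) j+m≤k) (+-cancelˡ-≤ j k m j+k≤n) = balancedMonochromatic-k-k≡0
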